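{- Let $k\ge3$, $m\ge1$ with $mk+2$ even, $W=I_2(k)$, and let $\Gamma^{(m)}$ be its $m$-cluster complex with Fomin–Reading rotation $\mathcal{R}_m$, and let $\rho=\mathcal{R}_m^{(mk+2)/2}$ (the half-turn). If $k$ is odd, no vertex of $\Gamma^{(m)}$ (equivalently, no face of rank-one parabolic type) is fixed by $\rho$. If $k$ is even, every vertex of $\Gamma^{(m)}$ is fixed by $\rho$.
   Context: $W=I_2(k)$ is the dihedral group of order $2k$ with root system $\Phi$, simple roots $\alpha_1,\alpha_2$, simple reflections $s_1,s_2$, $c_+=s_1$, $c_-=s_2$. Almost positive roots: $\Phi_{\ge-1}=\Phi_+\cup\{ -\alpha_1,-\alpha_2\}$. Fomin–Zelevinsky rotation: $\tau_+(\alpha)=\alpha$ if $\alpha=-\alpha_2$, else $c_+(\alpha)$; $\tau_-(\alpha)=\alpha$ if $\alpha=-\alpha_1$, else $c_-(\alpha)$; $\mathcal{R}=\tau_-\tau_+$. $m$-colored almost positive roots: $\Phi^{(m)}_{\ge-1}=\{\alpha^i:\alpha\in\Phi_+,1\le i\le m\}\cup\{(-\alpha_1)^1,(-\alpha_2)^1\}$. Fomin–Reading rotation: $\mathcal{R}_m(\alpha^i)=\alpha^{i+1}$ if $\alpha\in\Phi_+$ and $i<m$, and $(\mathcal{R}(\alpha))^1$ otherwise; its order divides $mk+2$. Compatibility: the unique symmetric relation with $(-\alpha_j)^1\|\beta^i$ iff $\alpha_j$ has coefficient $0$ in $\beta$, invariant under $\mathcal{R}_m$. $\Gamma^{(m)}$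 is the simplicial complex of pairwise compatible sets; its vertices are the elements of $\Phi^{(m)}_{\ge-1}$. -}

module Defs where

open import Data.Nat using (ℕ; zero; suc; _+_; _*_; _∸_; pred; _<?_; _≟_)
open import Data.Nat.DivMod using (_%_)
open import Data.Fin using (Fin; toℕ; fromℕ<)
open import Relation.Nullary using (yes; no)

-- The 2k roots are the unit vectors at angles jπ/k, j ∈ ℤ/2k; root "r j" is
-- encoded by the natural number j, read modulo 2k.
-- Simple roots: α₁ = r 0 (angle 0), α₂ = r (k-1) (angle (k-1)π/k),
-- so the positive roots are r 0, …, r (k-1) and  -r j = r (j + k).

-- 2k, written as a successor so that _%_ needs no instance (equals 2k for k ≥ 1)
twoK : ℕ → ℕ
twoK k = suc (pred k + k)

norm : ℕ → ℕ → ℕ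
norm k x = x % twoK k

α₁ α₂ : ℕ → ℕ
α₁ k = 0
α₂ k = k ∸ 1

neg : ℕ → ℕ → ℕ
neg k x = (x + k) % twoK k

-- reflection orthogonal to root r a : the vector at angle ψ goes to angle 2φ + π - ψ,
-- i.e. r j ↦ r (2a + k - j)
refl : ℕ → ℕ → ℕ → ℕ
refl k a x = (2 * a + k + (twoK k ∸ norm k x)) % twoK k

s₁ s₂ : ℕ → ℕ → ℕ
s₁ k = refl k (α₁ k)
s₂ k = refl k (α₂ k)

τ₊ : ℕ → ℕ → ℕ
τ₊ k x with norm k x ≟ neg k (α₂ k)
... | yes _ = x
... | no _  = s₁ k x

τ₋ : ℕ → ℕ → ℕ
τ₋ k x with norm k x ≟ neg k (α₁ k)
... | yes _ = x
... | no _  = s₂ k x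

ℛ : ℕ → ℕ → ℕ
ℛ k x = τ₋ k (τ₊ k x)

-- m-colored almost positive roots (= vertices of Γ^(m)), with m = suc m'.
-- col j i  is  (r j)^(i+1)  for a positive root r j (j < k) and colour i+1 ∈ {1..m};
-- neg₁ = (-α₁)^1,  neg₂ = (-α₂)^1.
data Vertex (k m : ℕ) : Set where
  col  : Fin k → Fin m → Vertex k m
  neg₁ : Vertex k m
  neg₂ : Vertex k m

rootOf : ∀ {k m} → Vertex k m → ℕ
rootOf (col j i) = toℕ j
rootOf {k} neg₁ = neg k (α₁ k)
rootOf {k} neg₂ = neg k (α₂ k)

colour1 : (k m' : ℕ) → ℕ → Vertex k (suc m')
colour1 k m' x with norm k x <? k
... | yes p = col (fromℕ< p) Fin.zero
... | no _ with norm k x ≟ k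
...   | yes _ = neg₁
...   | no _  = neg₂

ℛm : (k m' : ℕ) → Vertex k (suc m') → Vertex k (suc m')
ℛm k m' (col j i) with toℕ i <? m'
... | yes p = col j (Fin.suc (fromℕ< p))
... | no _  = colour1 k m' (ℛ k (toℕ j))
ℛm k m' neg₁ = colour1 k m' (ℛ k (rootOf {k} {suc m'} neg₁))
ℛm k m' neg₂ = colour1 k m' (ℛ k (rootOf {k} {suc m'} neg₂))

iter : {A : Set} → ℕ → (A → A) → A → A
iter zero    f x = x
iter (suc n) f x = f (iter n f x)

{-# OPTIONS --safe #-}
module Submission where

-- In the encoding of Defs the positive roots are 0, …, k − 1 (α₁ = 0, α₂ = k − 1) and
-- ℛ acts by j + 2 ↦ j on positive roots, 0 ↦ −α₁ ↦ k − 2 and 1 ↦ −α₂ ↦ k − 1.  The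
-- rotation ℛ_m runs through the m colours of a positive root before applying ℛ, so its
-- orbits are made of the descending chains −α₁ → k − 2 → k − 4 → ⋯ and
-- −α₂ → k − 1 → k − 3 → ⋯.  If k = 2t + 2 is even, each chain returns to its start after
-- (t + 1)m + 1 = (mk + 2)/2 steps, and every vertex lies on one of them, so ρ is the
-- identity.  If k is odd (so m is even), the chain from −α₁ ends at −α₂ and vice versa:
-- ρ moves −α₁ to a coloured copy of α₂, and as every vertex reaches −α₁, a vertex fixed
-- by ρ would make −α₁ fixed too.

open import Defs renaming (refl to reflect)
open import Data.Nat
open import Data.Nat.Properties
open import Data.Nat.DivMod using (m<n⇒m%n≡m; [m+kn]%n≡m%n)
open import Data.Nat.Divisibility using (_∣_; divides)
open import Data.Nat.Tactic.RingSolver using (solve-∀)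
open import Data.Fin as Fin using (Fin; toℕ; fromℕ<)
open import Data.Fin.Properties using (toℕ<n; toℕ-fromℕ<; fromℕ<-toℕ; fromℕ<-cong)
open import Data.Product using (_×_; _,_; ∃-syntax)
open import Data.Sum using (_⊎_; inj₁; inj₂; [_,_]′)
import Data.Sum as Sum
open import Function using (id; _∘_)
open import Relation.Nullary using (¬_; yes; no; contradiction)
open import Relation.Binary.PropositionalEquality

module Iteration {A : Set} (f : A → A) where

  iter-+ : ∀ a b x → iter (a + b) f x ≡ iter a f (iter b f x)
  iter-+ zero    b x = refl
  iter-+ (suc a) b x = cong f (iter-+ a b x)

  iter-comm : ∀ a b x → iter a f (iter b f x) ≡ iter b f (iter a f x)
  iter-comm a b x = begin
    iter a f (iter b f x) ≡⟨ iter-+ a b x ⟨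
    iter (a + b) f x      ≡⟨ cong (λ c → iter c f x) (+-comm a b) ⟩
    iter (b + a) f x      ≡⟨ iter-+ b a x ⟩
    iter b f (iter a f x) ∎
    where open ≡-Reasoning

  infix 4 _↝_

  _↝_ : A → A → Set
  x ↝ y = ∃[ b ] iter b f x ≡ y

  ↝-refl : ∀ {x} → x ↝ x
  ↝-refl = 0 , refl

  ↝-trans : ∀ {x y z} → x ↝ y → y ↝ z → x ↝ z
  ↝-trans {x} (a , refl) (b , refl) = b + a , iter-+ b a x

  ↝-periodic : ∀ h {x y} → x ↝ y → iter h f x ≡ x → iter h f y ≡ y
  ↝-periodic h {x} (b , refl) x-fixed =
    trans (iter-comm h b x) (cong (iter b f) x-fixed)

reflect-≡ : ∀ k a x c l → x < twoK k → c < twoK k →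
            2 * a + k + twoK k ≡ c + x + l * twoK k → reflect k a x ≡ c
reflect-≡ k a x c l x<2k c<2k eq = begin
  (2 * a + k + (twoK k ∸ x % twoK k)) % twoK k ≡⟨ cong (λ r → (2 * a + k + (twoK k ∸ r)) % twoK k) (m<n⇒m%n≡m x<2k) ⟩
  (2 * a + k + (twoK k ∸ x)) % twoK k          ≡⟨ cong (_% twoK k) (+-cancelʳ-≡ x _ _ shifted) ⟩
  (c + l * twoK k) % twoK k                    ≡⟨ [m+kn]%n≡m%n c l (twoK k) ⟩
  c % twoK k                                   ≡⟨ m<n⇒m%n≡m c<2k ⟩
  c                                            ∎
  where
  open ≡-Reasoning
  shifted : 2 * a + k + (twoK k ∸ x) + x ≡ c + l * twoK k + x
  shifted = begin
    2 * a + k + (twoK k ∸ x) + x   ≡⟨ +-assoc (2 * a + k) _ x ⟩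
    2 * a + k + (twoK k ∸ x + x)   ≡⟨ cong (2 * a + k +_) (m∸n+n≡m (<⇒≤ x<2k)) ⟩
    2 * a + k + twoK k             ≡⟨ eq ⟩
    c + x + l * twoK k             ≡⟨ +-assoc c x _ ⟩
    c + (x + l * twoK k)           ≡⟨ cong (c +_) (+-comm x _) ⟩
    c + (l * twoK k + x)           ≡⟨ +-assoc c _ x ⟨
    c + l * twoK k + x             ∎

module Roots (n : ℕ) where

  k : ℕ
  k = suc (suc n)

  -α₁ -α₂ : ℕ
  -α₁ = k
  -α₂ = α₂ k + k

  k<2k : k < twoK k
  k<2k = s≤s (m≤n+m k (suc n))

  -α₂<2k : -α₂ < twoK k
  -α₂<2k = ≤-refl

  n<k : n < k
  n<k = m<n+m n (s≤s z≤n)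

  α₂<k : α₂ k < k
  α₂<k = n<1+n (suc n)

  k<-α₂ : k < -α₂
  k<-α₂ = s≤s (m≤n+m k n)

  norm-< : ∀ {x} → x < twoK k → norm k x ≡ x
  norm-< = m<n⇒m%n≡m

  neg[α₁]≡-α₁ : neg k (α₁ k) ≡ -α₁
  neg[α₁]≡-α₁ = norm-< k<2k

  neg[α₂]≡-α₂ : neg k (α₂ k) ≡ -α₂
  neg[α₂]≡-α₂ = norm-< -α₂<2k

  τ₊[-α₂]≡-α₂ : τ₊ k -α₂ ≡ -α₂
  τ₊[-α₂]≡-α₂ with norm k -α₂ ≟ neg k (α₂ k)
  ... | yes _ = refl
  ... | no ≢neg = contradiction (trans (norm-< -α₂<2k) (sym neg[α₂]≡-α₂)) ≢neg

  τ₊-reflects : ∀ {x} → x < twoK k → x ≢ -α₂ → τ₊ k x ≡ s₁ k x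
  τ₊-reflects {x} x<2k x≢ with norm k x ≟ neg k (α₂ k)
  ... | yes ≡neg = contradiction (trans (sym (norm-< x<2k)) (trans ≡neg neg[α₂]≡-α₂)) x≢
  ... | no _ = refl

  τ₋[-α₁]≡-α₁ : τ₋ k -α₁ ≡ -α₁
  τ₋[-α₁]≡-α₁ with norm k -α₁ ≟ neg k (α₁ k)
  ... | yes _ = refl
  ... | no ≢neg = contradiction (trans (norm-< k<2k) (sym neg[α₁]≡-α₁)) ≢neg

  τ₋-reflects : ∀ {x} → x < twoK k → x ≢ -α₁ → τ₋ k x ≡ s₂ k x
  τ₋-reflects {x} x<2k x≢ with norm k x ≟ neg k (α₁ k)
  ... | yes ≡neg = contradiction (trans (sym (norm-< x<2k)) (trans ≡neg neg[α₁]≡-α₁)) x≢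
  ... | no _ = refl

  τ₊[j]≡k∸j : ∀ {j} → j ≤ k → τ₊ k j ≡ k ∸ j
  τ₊[j]≡k∸j {j} j≤k = trans (τ₊-reflects j<2k (<⇒≢ (≤-<-trans j≤k k<-α₂)))
                      (reflect-≡ k 0 j (k ∸ j) 1 j<2k (≤-<-trans (m∸n≤m k j) k<2k) eq)
    where
    j<2k : j < twoK k
    j<2k = ≤-<-trans j≤k k<2k
    eq : k + twoK k ≡ k ∸ j + j + 1 * twoK k
    eq = cong₂ _+_ (sym (m∸n+n≡m j≤k)) (sym (*-identityˡ (twoK k)))

  τ₋[y]≡n∸y : ∀ {y} → y ≤ n → τ₋ k y ≡ n ∸ y
  τ₋[y]≡n∸y {y} y≤n = trans (τ₋-reflects y<2k (<⇒≢ (≤-<-trans y≤n n<k)))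
                      (reflect-≡ k (suc n) y (n ∸ y) 2 y<2k (≤-<-trans (m∸n≤m n y) n<2k) eq)
    where
    n<2k : n < twoK k
    n<2k = <-trans n<k k<2k
    y<2k : y < twoK k
    y<2k = ≤-<-trans y≤n n<2k
    eq : 2 * suc n + k + twoK k ≡ n ∸ y + y + 2 * twoK k
    eq = trans (lemma n) (cong (_+ 2 * twoK k) (sym (m∸n+n≡m y≤n)))
      where
      lemma : ∀ n → 2 * suc n + suc (suc n) + suc (suc n + suc (suc n)) ≡ n + 2 * suc (suc n + suc (suc n))
      lemma = solve-∀

  s₂[α₂]≡-α₂ : s₂ k (α₂ k) ≡ -α₂
  s₂[α₂]≡-α₂ = reflect-≡ k (α₂ k) (α₂ k) -α₂ 1 (<-trans α₂<k k<2k) -α₂<2k (lemma n)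
    where
    lemma : ∀ n → 2 * suc n + suc (suc n) + suc (suc n + suc (suc n))
                ≡ suc n + suc (suc n) + suc n + 1 * suc (suc n + suc (suc n))
    lemma = solve-∀

  s₂[-α₂]≡α₂ : s₂ k -α₂ ≡ α₂ k
  s₂[-α₂]≡α₂ = reflect-≡ k (α₂ k) -α₂ (α₂ k) 1 -α₂<2k (<-trans α₂<k k<2k) (lemma n)
    where
    lemma : ∀ n → 2 * suc n + suc (suc n) + suc (suc n + suc (suc n))
                ≡ suc n + (suc n + suc (suc n)) + 1 * suc (suc n + suc (suc n))
    lemma = solve-∀

  ℛ[0]≡-α₁ : ℛ k 0 ≡ -α₁
  ℛ[0]≡-α₁ = trans (cong (τ₋ k) (τ₊[j]≡k∸j z≤n)) τ₋[-α₁]≡-α₁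

  ℛ[1]≡-α₂ : ℛ k 1 ≡ -α₂
  ℛ[1]≡-α₂ = begin
    τ₋ k (τ₊ k 1) ≡⟨ cong (τ₋ k) (τ₊[j]≡k∸j (s≤s z≤n)) ⟩
    τ₋ k (α₂ k)   ≡⟨ τ₋-reflects (<-trans α₂<k k<2k) (<⇒≢ α₂<k) ⟩
    s₂ k (α₂ k)   ≡⟨ s₂[α₂]≡-α₂ ⟩
    -α₂           ∎
    where open ≡-Reasoning

  ℛ[2+j]≡j : ∀ {j} → j ≤ n → ℛ k (suc (suc j)) ≡ j
  ℛ[2+j]≡j {j} j≤n = begin
    τ₋ k (τ₊ k (suc (suc j))) ≡⟨ cong (τ₋ k) (τ₊[j]≡k∸j (s≤s (s≤s j≤n))) ⟩
    τ₋ k (n ∸ j)              ≡⟨ τ₋[y]≡n∸y (m∸n≤m n j) ⟩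
    n ∸ (n ∸ j)               ≡⟨ m∸[m∸n]≡n j≤n ⟩
    j                         ∎
    where open ≡-Reasoning

  ℛ[-α₂]≡α₂ : ℛ k -α₂ ≡ α₂ k
  ℛ[-α₂]≡α₂ = begin
    τ₋ k (τ₊ k -α₂) ≡⟨ cong (τ₋ k) τ₊[-α₂]≡-α₂ ⟩
    τ₋ k -α₂        ≡⟨ τ₋-reflects -α₂<2k (>⇒≢ k<-α₂) ⟩
    s₂ k -α₂        ≡⟨ s₂[-α₂]≡α₂ ⟩
    α₂ k            ∎
    where open ≡-Reasoning

module Rotation (n m' : ℕ) where

  open Roots n public

  m : ℕ
  m = suc m'

  f : Vertex k m → Vertex k m
  f = ℛm k m'

  open Iteration f public

  infix 10 _¹

  _¹ : ℕ → Vertex k m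
  x ¹ = colour1 k m' x

  positive-¹ : ∀ {j} (j<k : j < k) → j ¹ ≡ col (fromℕ< j<k) Fin.zero
  positive-¹ {j} j<k with norm k j <? k
  ... | yes j%<k = cong (λ i → col i Fin.zero) (fromℕ<-cong _ _ (norm-< j<2k) j%<k j<k)
    where
    j<2k : j < twoK k
    j<2k = <-trans j<k k<2k
  ... | no j%≮k = contradiction (subst (_< k) (sym (norm-< (<-trans j<k k<2k))) j<k) j%≮k

  toℕ-¹ : ∀ (j : Fin k) → toℕ j ¹ ≡ col j Fin.zero
  toℕ-¹ j = trans (positive-¹ (toℕ<n j)) (cong (λ i → col i Fin.zero) (fromℕ<-toℕ j (toℕ<n j)))

  -α₁¹≡neg₁ : -α₁ ¹ ≡ neg₁
  -α₁¹≡neg₁ with norm k -α₁ <? k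
  ... | yes k%<k = contradiction (subst (_< k) (norm-< k<2k) k%<k) (<-irrefl refl)
  ... | no _ with norm k -α₁ ≟ k
  ...   | yes _ = refl
  ...   | no k%≢k = contradiction (norm-< k<2k) k%≢k

  -α₂¹≡neg₂ : -α₂ ¹ ≡ neg₂
  -α₂¹≡neg₂ with norm k -α₂ <? k
  ... | yes -α₂%<k = contradiction (subst (_< k) (norm-< -α₂<2k) -α₂%<k) (<-asym k<-α₂)
  ... | no _ with norm k -α₂ ≟ k
  ...   | yes -α₂%≡k = contradiction (trans (sym (norm-< -α₂<2k)) -α₂%≡k) (>⇒≢ k<-α₂)
  ...   | no _ = refl

  ℛ[0]¹≡neg₁ : ℛ k 0 ¹ ≡ neg₁
  ℛ[0]¹≡neg₁ = trans (cong _¹ ℛ[0]≡-α₁) -α₁¹≡neg₁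

  ℛ[1]¹≡neg₂ : ℛ k 1 ¹ ≡ neg₂
  ℛ[1]¹≡neg₂ = trans (cong _¹ ℛ[1]≡-α₂) -α₂¹≡neg₂

  ℛm[neg₁]≡n¹ : f neg₁ ≡ n ¹
  ℛm[neg₁]≡n¹ = trans (cong (λ x → ℛ k x ¹) neg[α₁]≡-α₁) (cong _¹ (ℛ[2+j]≡j ≤-refl))

  ℛm[neg₂]≡α₂¹ : f neg₂ ≡ α₂ k ¹
  ℛm[neg₂]≡α₂¹ = trans (cong (λ x → ℛ k x ¹) neg[α₂]≡-α₂) (cong _¹ ℛ[-α₂]≡α₂)

  ℛm-next-colour : ∀ (j : Fin k) (i : Fin m) (i<m' : toℕ i < m') → f (col j i) ≡ col j (Fin.suc (fromℕ< i<m'))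
  ℛm-next-colour j i i<m' with toℕ i <? m'
  ... | yes _ = refl
  ... | no i≮m' = contradiction i<m' i≮m'

  ℛm-last-colour : ∀ (j : Fin k) (i : Fin m) → toℕ i ≡ m' → f (col j i) ≡ ℛ k (toℕ j) ¹
  ℛm-last-colour j i i≡m' with toℕ i <? m'
  ... | yes i<m' = contradiction i≡m' (<⇒≢ i<m')
  ... | no _ = refl

  iter-col : ∀ (j : Fin k) (i : Fin m) d (d+i<m : d + toℕ i < m) →
             iter d f (col j i) ≡ col j (fromℕ< d+i<m)
  iter-col j i zero    i<m     = cong (col j) (sym (fromℕ<-toℕ i i<m))
  iter-col j i (suc d) 1+d+i<m = begin
    f (iter d f (col j i))              ≡⟨ cong f (iter-col j i d d+i<m) ⟩
    f (col j (fromℕ< d+i<m))            ≡⟨ ℛm-next-colour j _ not-last ⟩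
    col j (Fin.suc (fromℕ< not-last))   ≡⟨ cong (col j ∘ Fin.suc) (fromℕ<-cong _ _ (toℕ-fromℕ< d+i<m) not-last d+i<m') ⟩
    col j (Fin.suc (fromℕ< d+i<m'))     ∎
    where
    open ≡-Reasoning
    d+i<m' : d + toℕ i < m'
    d+i<m' = s<s⁻¹ 1+d+i<m
    d+i<m : d + toℕ i < m
    d+i<m = <-trans d+i<m' (n<1+n m')
    not-last : toℕ (fromℕ< d+i<m) < m'
    not-last = subst (_< m') (sym (toℕ-fromℕ< d+i<m)) d+i<m'

  iter-colour : ∀ (j : Fin k) (i : Fin m) → iter (toℕ i) f (col j Fin.zero) ≡ col j i
  iter-colour j i = trans (iter-col j Fin.zero (toℕ i) i+0<m)
    (cong (col j) (trans (fromℕ<-cong _ _ (+-identityʳ (toℕ i)) i+0<m (toℕ<n i)) (fromℕ<-toℕ i (toℕ<n i))))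
    where
    i+0<m : toℕ i + 0 < m
    i+0<m = subst (_< m) (sym (+-identityʳ (toℕ i))) (toℕ<n i)

  iter-col-next : ∀ (j : Fin k) (i : Fin m) → iter (suc (m' ∸ toℕ i)) f (col j i) ≡ ℛ k (toℕ j) ¹
  iter-col-next j i = trans (cong f (iter-col j i (m' ∸ toℕ i) last<m))
                            (ℛm-last-colour j _ (trans (toℕ-fromℕ< last<m) (m∸n+n≡m i≤m')))
    where
    i≤m' : toℕ i ≤ m'
    i≤m' = s≤s⁻¹ (toℕ<n i)
    last<m : m' ∸ toℕ i + toℕ i < m
    last<m = s≤s (≤-reflexive (m∸n+n≡m i≤m'))

  iter-m-¹ : ∀ {j} → j < k → iter m f (j ¹) ≡ ℛ k j ¹
  iter-m-¹ {j} j<k = begin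
    iter m f (j ¹)                       ≡⟨ cong (iter m f) (positive-¹ j<k) ⟩
    iter m f (col (fromℕ< j<k) Fin.zero) ≡⟨ iter-col-next (fromℕ< j<k) Fin.zero ⟩
    ℛ k (toℕ (fromℕ< j<k)) ¹             ≡⟨ cong (λ x → ℛ k x ¹) (toℕ-fromℕ< j<k) ⟩
    ℛ k j ¹                              ∎
    where open ≡-Reasoning

  iter-m-[2+j]¹ : ∀ {j} → suc (suc j) < k → iter m f (suc (suc j) ¹) ≡ j ¹
  iter-m-[2+j]¹ j+2<k = trans (iter-m-¹ j+2<k) (cong _¹ (ℛ[2+j]≡j (<⇒≤ (s≤s⁻¹ (s≤s⁻¹ j+2<k)))))

  iter-descend : ∀ s j → j + s * 2 < k → iter (s * m) f ((j + s * 2) ¹) ≡ j ¹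
  iter-descend zero    j _     = cong _¹ (+-identityʳ j)
  iter-descend (suc s) j top<k = begin
    iter (m + s * m) f ((j + suc s * 2) ¹)              ≡⟨ iter-+ m (s * m) _ ⟩
    iter m f (iter (s * m) f ((j + suc s * 2) ¹))       ≡⟨ cong (λ x → iter m f (iter (s * m) f (x ¹))) shift ⟩
    iter m f (iter (s * m) f ((suc (suc j) + s * 2) ¹)) ≡⟨ cong (iter m f) (iter-descend s (suc (suc j)) top<k′) ⟩
    iter m f (suc (suc j) ¹)                            ≡⟨ iter-m-[2+j]¹ (≤-<-trans (m≤m+n _ (s * 2)) top<k′) ⟩
    j ¹                                                 ∎
    where
    open ≡-Reasoning
    shift : j + suc s * 2 ≡ suc (suc j) + s * 2
    shift = trans (+-suc j _) (cong suc (+-suc j _))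
    top<k′ : suc (suc j) + s * 2 < k
    top<k′ = subst (_< k) shift top<k

  iter-chain : ∀ a t {A x} → x < k → x ≡ a + t * 2 → f A ≡ x ¹ → iter (suc t * m + 1) f A ≡ ℛ k a ¹
  iter-chain a t {A} top<k refl fA = begin
    iter (suc t * m + 1) f A                  ≡⟨ iter-+ (suc t * m) 1 A ⟩
    iter (m + t * m) f (f A)                  ≡⟨ cong (iter (m + t * m) f) fA ⟩
    iter (m + t * m) f ((a + t * 2) ¹)        ≡⟨ iter-+ m (t * m) _ ⟩
    iter m f (iter (t * m) f ((a + t * 2) ¹)) ≡⟨ cong (iter m f) (iter-descend t a top<k) ⟩
    iter m f (a ¹)                            ≡⟨ iter-m-¹ (≤-<-trans (m≤m+n a (t * 2)) top<k) ⟩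
    ℛ k a ¹                                   ∎
    where open ≡-Reasoning

  ℛ¹-reaches-negative : ∀ j → j < k → ℛ k j ¹ ↝ neg₁ ⊎ ℛ k j ¹ ↝ neg₂
  ℛ¹-reaches-negative zero          _      = inj₁ (0 , ℛ[0]¹≡neg₁)
  ℛ¹-reaches-negative (suc zero)    _      = inj₂ (0 , ℛ[1]¹≡neg₂)
  ℛ¹-reaches-negative (suc (suc j)) j+2<k =
    Sum.map (↝-trans down) (↝-trans down) (ℛ¹-reaches-negative j j<k)
    where
    j<k : j < k
    j<k = ≤-<-trans (m≤n+m j 2) j+2<k
    down : ℛ k (suc (suc j)) ¹ ↝ ℛ k j ¹
    down = m , trans (cong (λ x → iter m f (x ¹)) (ℛ[2+j]≡j (<⇒≤ (s≤s⁻¹ (s≤s⁻¹ j+2<k))))) (iter-m-¹ j<k)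

  reaches-negative : ∀ v → v ↝ neg₁ ⊎ v ↝ neg₂
  reaches-negative (col j i) =
    Sum.map (↝-trans next) (↝-trans next) (ℛ¹-reaches-negative (toℕ j) (toℕ<n j))
    where
    next : col j i ↝ ℛ k (toℕ j) ¹
    next = suc (m' ∸ toℕ i) , iter-col-next j i
  reaches-negative neg₁ = inj₁ ↝-refl
  reaches-negative neg₂ = inj₂ ↝-refl

  negative-reaches-¹ : ∀ d j → j + d ≡ suc n → neg₁ ↝ j ¹ ⊎ neg₂ ↝ j ¹
  negative-reaches-¹ zero          j j≡ = inj₂ (1 , trans ℛm[neg₂]≡α₂¹ (cong _¹ (trans (sym j≡) (+-identityʳ j))))
  negative-reaches-¹ (suc zero)    j j≡ = inj₁ (1 , trans ℛm[neg₁]≡n¹ (cong _¹ (suc-injective (trans (sym j≡) (+-comm j 1)))))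
  negative-reaches-¹ (suc (suc d)) j j≡ =
    Sum.map (λ r → ↝-trans r down) (λ r → ↝-trans r down) (negative-reaches-¹ d (suc (suc j)) j+2+d≡)
    where
    j+2+d≡ : suc (suc j) + d ≡ suc n
    j+2+d≡ = trans (sym (trans (+-suc j _) (cong suc (+-suc j d)))) j≡
    down : suc (suc j) ¹ ↝ j ¹
    down = m , iter-m-[2+j]¹ (s≤s (subst (suc (suc j) ≤_) j+2+d≡ (m≤m+n _ d)))

  reached-from-negative : ∀ v → neg₁ ↝ v ⊎ neg₂ ↝ v
  reached-from-negative (col j i) =
    Sum.map (λ r → ↝-trans r climb) (λ r → ↝-trans r climb)
            (negative-reaches-¹ (suc n ∸ toℕ j) (toℕ j) (m+[n∸m]≡n (s≤s⁻¹ (toℕ<n j))))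
    where
    climb : toℕ j ¹ ↝ col j i
    climb = toℕ i , trans (cong (iter (toℕ i) f) (toℕ-¹ j)) (iter-colour j i)
  reached-from-negative neg₁ = inj₁ ↝-refl
  reached-from-negative neg₂ = inj₂ ↝-refl

  even-half-turn : ∀ t → n ≡ t * 2 → ∀ v → iter (suc t * m + 1) f v ≡ v
  even-half-turn t n≡ v =
    [ (λ r → ↝-periodic H r neg₁-fixed) , (λ r → ↝-periodic H r neg₂-fixed) ]′ (reached-from-negative v)
    where
    H : ℕ
    H = suc t * m + 1
    neg₁-fixed : iter H f neg₁ ≡ neg₁
    neg₁-fixed = trans (iter-chain 0 t n<k n≡ ℛm[neg₁]≡n¹) ℛ[0]¹≡neg₁
    neg₂-fixed : iter H f neg₂ ≡ neg₂
    neg₂-fixed = trans (iter-chain 1 t α₂<k (cong suc n≡) ℛm[neg₂]≡α₂¹) ℛ[1]¹≡neg₂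

  odd-reaches-neg₁ : ∀ t → n ≡ suc (t * 2) → ∀ v → v ↝ neg₁
  odd-reaches-neg₁ t n≡ v =
    [ id , (λ r → ↝-trans r (suc (suc t) * m + 1 , neg₂→neg₁)) ]′ (reaches-negative v)
    where
    neg₂→neg₁ : iter (suc (suc t) * m + 1) f neg₂ ≡ neg₁
    neg₂→neg₁ = trans (iter-chain 0 (suc t) α₂<k (cong suc n≡) ℛm[neg₂]≡α₂¹) ℛ[0]¹≡neg₁

  odd-iter-neg₁ : ∀ t u (u<m : u + 0 < m) → n ≡ suc (t * 2) →
                  iter (u + suc (suc t * m + 1)) f neg₁ ≡ col (fromℕ< α₂<k) (fromℕ< u<m)
  odd-iter-neg₁ t u u<m n≡ = begin
    iter (u + suc (suc t * m + 1)) f neg₁      ≡⟨ iter-+ u _ neg₁ ⟩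
    iter u f (f (iter (suc t * m + 1) f neg₁)) ≡⟨ cong (iter u f ∘ f) neg₁→neg₂ ⟩
    iter u f (f neg₂)                          ≡⟨ cong (iter u f) (trans ℛm[neg₂]≡α₂¹ (positive-¹ α₂<k)) ⟩
    iter u f (col (fromℕ< α₂<k) Fin.zero)      ≡⟨ iter-col _ Fin.zero u u<m ⟩
    col (fromℕ< α₂<k) (fromℕ< u<m)             ∎
    where
    open ≡-Reasoning
    neg₁→neg₂ : iter (suc t * m + 1) f neg₁ ≡ neg₂
    neg₁→neg₂ = trans (iter-chain 1 t n<k n≡ ℛm[neg₁]≡n¹) ℛ[1]¹≡neg₂

  odd-half-turn : ∀ t u → n ≡ suc (t * 2) → m' ≡ suc (u * 2) →
                  ∀ v → iter (u + suc (suc t * m + 1)) f v ≢ v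
  odd-half-turn t u n≡ m'≡ v v-fixed =
    col≢neg₁ (trans (sym (odd-iter-neg₁ t u u<m n≡))
                    (↝-periodic (u + suc (suc t * m + 1)) (odd-reaches-neg₁ t n≡ v) v-fixed))
    where
    col≢neg₁ : ∀ {j : Fin k} {i : Fin m} → col j i ≢ neg₁
    col≢neg₁ ()
    u<m : u + 0 < m
    u<m = begin-strict
      u + 0       ≡⟨ +-identityʳ u ⟩
      u           ≤⟨ m≤m*n u 2 ⟩
      u * 2       <⟨ n<1+n (u * 2) ⟩
      suc (u * 2) ≡⟨ m'≡ ⟨
      m'          <⟨ n<1+n m' ⟩
      m           ∎
      where open ≤-Reasoning

even-or-odd : ∀ n → (∃[ t ] n ≡ t * 2) ⊎ (∃[ t ] n ≡ suc (t * 2))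
even-or-odd zero = inj₁ (0 , refl)
even-or-odd (suc n) with even-or-odd n
... | inj₁ (t , n≡) = inj₂ (t , cong suc n≡)
... | inj₂ (t , n≡) = inj₁ (suc t , cong suc n≡)

half-even : ∀ m n t h → n ≡ t * 2 → m * suc (suc n) + 2 ≡ 2 * h → h ≡ suc t * m + 1
half-even m n t h refl eq = *-cancelˡ-≡ h _ 2 (trans (sym eq) (lemma m t))
  where
  lemma : ∀ m t → m * suc (suc (t * 2)) + 2 ≡ 2 * (suc t * m + 1)
  lemma = solve-∀

half-odd : ∀ m' n t u h → n ≡ suc (t * 2) → m' ≡ suc (u * 2) →
           suc m' * suc (suc n) + 2 ≡ 2 * h → h ≡ u + suc (suc t * suc m' + 1)
half-odd m' n t u h refl refl eq = *-cancelˡ-≡ h _ 2 (trans (sym eq) (lemma t u))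
  where
  lemma : ∀ t u → suc (suc (u * 2)) * suc (suc (suc (t * 2))) + 2
                ≡ 2 * (u + suc (suc t * suc (suc (u * 2)) + 1))
  lemma = solve-∀

odd*odd+2≢even : ∀ m' n t u h → n ≡ suc (t * 2) → m' ≡ u * 2 → suc m' * suc (suc n) + 2 ≢ 2 * h
odd*odd+2≢even m' n t u h refl refl eq =
  even≢odd h (2 + t + 3 * u + 2 * u * t) (trans (sym eq) (lemma t u))
  where
  lemma : ∀ t u → suc (u * 2) * suc (suc (suc (t * 2))) + 2 ≡ suc (2 * (2 + t + 3 * u + 2 * u * t))
  lemma = solve-∀

lemma7p4 : (k m' h : ℕ) → 3 ≤ k → suc m' * k + 2 ≡ 2 * h →
    ((¬ (2 ∣ k)) → (v : Vertex k (suc m')) → iter h (ℛm k m') v ≢ v)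
    × ((2 ∣ k) → (v : Vertex k (suc m')) → iter h (ℛm k m') v ≡ v)
lemma7p4 (suc (suc (suc q))) m' h (s≤s (s≤s (s≤s z≤n))) mk+2≡2h = odd-case , even-case
  where
  open Rotation (suc q) m' using (k; f; even-half-turn; odd-half-turn)

  odd-case : ¬ 2 ∣ k → ∀ v → iter h f v ≢ v
  odd-case 2∤k v with even-or-odd (suc q) | even-or-odd m'
  ... | inj₁ (t , n≡) | _              = contradiction (divides (suc t) (cong (suc ∘ suc) n≡)) 2∤k
  ... | inj₂ (t , n≡) | inj₁ (u , m'≡) = contradiction mk+2≡2h (odd*odd+2≢even m' (suc q) t u h n≡ m'≡)
  ... | inj₂ (t , n≡) | inj₂ (u , m'≡) =
    subst (λ h → iter h f v ≢ v) (sym (half-odd m' (suc q) t u h n≡ m'≡ mk+2≡2h)) (odd-half-turn t u n≡ m'≡ v)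

  even-case : 2 ∣ k → ∀ v → iter h f v ≡ v
  even-case (divides (suc t) k≡) v =
    subst (λ h → iter h f v ≡ v) (sym (half-even (suc m') (suc q) t h n≡ mk+2≡2h)) (even-half-turn t n≡ v)
    where
    n≡ : suc q ≡ t * 2
    n≡ = suc-injective (suc-injective k≡)
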